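{- For every pfo-formula $\phi$, every reduction chain in the system $Y=(\mathrm{PFO},\to_{\{P\downarrow,S\downarrow,M\}})/\stackrel{*}{\leftrightarrow}_{ACO}$ starting in $[\phi]_{ACO}$ terminates and has length at most $|\phi|^3$, where $|\phi|$ is the number of nodes of the syntax tree of $\phi$.
   Context: A pfo-formula is a relational first-order formula with no negation ($\wedge,\vee$ binary); $\mathrm{PFO}$ is the class of all pfo-formulas; $\mathrm{free}(\psi)$ is its set of free variables. Rewriting rules (applicable to any subformula occurrence; $\oplus\in\{\wedge,\vee\}$, $Q\in\{\exists,\forall\}$): $A$: $F_1\oplus(F_2\oplus F_3)\to(F_1\oplus F_2)\oplus F_3$ and its converse; $C$: $F_1\oplus F_2\to F_2\oplus F_1$; $O$: $QxQyF\to QyQxF$; $P\!\downarrow$: $\exists x(F_1\wedge F_2)\to(\exists xF_1)\wedge F_2$ and $\forall x(F_1\vee F_2)\to(\forall xF_1)\vee F_2$ whenever $x\notin\mathrm{free}(F_2)$; $S\!\downarrow$: $\exists x(F_1\vee F_2)\to(\exists xF_1)\vee(\exists xF_2)$ and $\forall x(F_1\wedge F_2)\to(\forall xF_1)\wedge(\forall xF_2)$; $M$: $QxF\to F$ when $x\notin\mathrm{free}(F)$. For a set of rules $\mathcal{R}$, $\to_{\mathcal{R}}$ is the union of its rules, $\stackrel{*}{\leftrightarrow}_{\mathcal{R}}$ is the reflexive-transitive closure of $\to_{\mathcal{R}}$ with its inverse, and $[\phi]_{\mathcal{R}}$ is the $\stackrel{*}{\leftrightarrow}_{\mathcal{R}}$-class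 of $\phi$. For a system $(D,\to)$ and equivalence relation $\equiv$ on $D$, $(D,\to)/\equiv$ is the system on the $\equiv$-classes with $C\to C'$ iff some $d\in C$, $d'\in C'$ satisfy $d\to d'$. A reduction chain is a sequence $C_0\to C_1\to\cdots$; its length is the number of steps. -}

module Defs where

open import Data.Nat using (ℕ; zero; suc; _+_; _^_; _≤_; _≟_)
open import Data.List using (List; _++_; filter)
open import Data.List.Membership.Propositional using (_∈_)
open import Data.Product using (Σ; _×_; ∃)
open import Relation.Nullary using (¬_; ¬?)
open import Relation.Binary.Construct.Closure.Equivalence using (EqClosure)

Var : Set
Var = ℕ

data BinOp : Set where
  and or : BinOp

data Quant : Set where
  ex all : Quant

-- pfo-formulas: relational atoms, binary ∧/∨, ∃x, ∀x; no negation.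
data Formula : Set where
  atom  : ℕ → List Var → Formula
  bin   : BinOp → Formula → Formula → Formula
  quant : Quant → Var → Formula → Formula

free : Formula → List Var
free (atom R xs) = xs
free (bin o F G) = free F ++ free G
free (quant q x F) = filter (λ y → ¬? (y ≟ x)) (free F)

size : Formula → ℕ
size (atom R xs) = 1
size (bin o F G) = suc (size F + size G)
size (quant q x F) = suc (size F)

Rel : Set₁
Rel = Formula → Formula → Set

data Ctx (R : Rel) : Rel where
  here  : ∀ {F G} → R F G → Ctx R F G
  binL  : ∀ {o F F' G} → Ctx R F F' → Ctx R (bin o F G) (bin o F' G)
  binR  : ∀ {o F G G'} → Ctx R G G' → Ctx R (bin o F G) (bin o F G')
  quantC : ∀ {q x F F'} → Ctx R F F' → Ctx R (quant q x F) (quant q x F')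

data ACOroot : Rel where
  A  : ∀ {o F₁ F₂ F₃} → ACOroot (bin o F₁ (bin o F₂ F₃)) (bin o (bin o F₁ F₂) F₃)
  A⁻ : ∀ {o F₁ F₂ F₃} → ACOroot (bin o (bin o F₁ F₂) F₃) (bin o F₁ (bin o F₂ F₃))
  C  : ∀ {o F₁ F₂} → ACOroot (bin o F₁ F₂) (bin o F₂ F₁)
  O  : ∀ {q x y F} → ACOroot (quant q x (quant q y F)) (quant q y (quant q x F))

data PSMroot : Rel where
  P∃ : ∀ {x F₁ F₂} → ¬ (x ∈ free F₂) →
       PSMroot (quant ex x (bin and F₁ F₂)) (bin and (quant ex x F₁) F₂)
  P∀ : ∀ {x F₁ F₂} → ¬ (x ∈ free F₂) →
       PSMroot (quant all x (bin or F₁ F₂)) (bin or (quant all x F₁) F₂)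
  S∃ : ∀ {x F₁ F₂} →
       PSMroot (quant ex x (bin or F₁ F₂)) (bin or (quant ex x F₁) (quant ex x F₂))
  S∀ : ∀ {x F₁ F₂} →
       PSMroot (quant all x (bin and F₁ F₂)) (bin and (quant all x F₁) (quant all x F₂))
  M  : ∀ {q x F} → ¬ (x ∈ free F) → PSMroot (quant q x F) F

_→ACO_ : Rel
_→ACO_ = Ctx ACOroot

_→PSM_ : Rel
_→PSM_ = Ctx PSMroot

_≈ACO_ : Rel
_≈ACO_ = EqClosure _→ACO_

-- step of the quotient system Y between the classes [ψ] and [ψ']
_⇒Y_ : Rel
ψ ⇒Y ψ' = Σ Formula λ d → Σ Formula λ d' → ψ ≈ACO d × d →PSM d' × d' ≈ACO ψ'

data Chain : ℕ → Formula → Set where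
  stop : ∀ {ψ} → Chain zero ψ
  step : ∀ {n ψ ψ'} → ψ ⇒Y ψ' → Chain n ψ' → Chain (suc n) ψ

InfiniteChain : Formula → Set
InfiniteChain φ = Σ (ℕ → Formula) λ f → (f zero ≈ACO φ) × (∀ i → f i ⇒Y f (suc i))

{-# OPTIONS --safe #-}
module Submission where

open import Defs
open import Data.Nat using (ℕ; zero; suc; _+_; _*_; _^_; _≤_; _<_; _>_; NonZero; s≤s; z≤n; z<s)
open import Data.Nat.Properties
open import Data.Nat.Tactic.RingSolver using (solve-∀)
open import Data.Product using (_×_; _,_)
open import Relation.Nullary using (¬_)
open import Relation.Binary.PropositionalEquality using (_≡_; refl; sym; cong; cong₂; isEquivalence)
open import Relation.Binary.Core using (_Preserves_⟶_)
open import Relation.Binary.Construct.Closure.Equivalence using (gfold; symmetric; transitive)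

-- Give every quantifier occurrence the weight 2c + 1, where c is the number of binary
-- connectives in its scope, and let the weight of a formula be the sum over its quantifiers.
-- Rules A, C, O permute connectives and quantifiers without changing any scope's connective
-- count, so the weight is constant on ACO-classes. Each of P↓, S↓, M strictly lowers it:
-- P↓ removes F₂'s connectives and the root connective from the scope of x, S↓ replaces one
-- quantifier of weight 2(c₁ + c₂ + 1) + 1 by two of total weight 2(c₁ + c₂) + 2, and M drops
-- a quantifier. Hence every chain is at most as long as the initial weight, which is ≤ |φ|².

connectives : Formula → ℕ
connectives (atom _ _)    = 0
connectives (bin _ F G)   = suc (connectives F + connectives G)
connectives (quant _ _ F) = connectives F

weight : Formula → ℕ
weight (atom _ _)    = 0
weight (bin _ F G)   = weight F + weight G
weight (quant _ _ F) = weight F + suc (2 * connectives F)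

Ctx-connectives : ∀ {R} → connectives Preserves R ⟶ _≡_ → connectives Preserves Ctx R ⟶ _≡_
Ctx-connectives root (here r)         = root r
Ctx-connectives root (binL {G = G} s) = cong (λ c → suc (c + connectives G)) (Ctx-connectives root s)
Ctx-connectives root (binR {F = F} s) = cong (λ c → suc (connectives F + c)) (Ctx-connectives root s)
Ctx-connectives root (quantC s)       = Ctx-connectives root s

Ctx-weight : ∀ {R} → connectives Preserves R ⟶ _≡_ →
             weight Preserves R ⟶ _≡_ → weight Preserves Ctx R ⟶ _≡_
Ctx-weight conn root (here r)         = root r
Ctx-weight conn root (binL {G = G} s) = cong (_+ weight G) (Ctx-weight conn root s)
Ctx-weight conn root (binR {F = F} s) = cong (weight F +_) (Ctx-weight conn root s)
Ctx-weight conn root (quantC s)       =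
  cong₂ (λ w c → w + suc (2 * c)) (Ctx-weight conn root s) (Ctx-connectives conn s)

Ctx-weight-> : ∀ {R} → connectives Preserves R ⟶ _≡_ →
               weight Preserves R ⟶ _>_ → weight Preserves Ctx R ⟶ _>_
Ctx-weight-> conn root (here r)         = root r
Ctx-weight-> conn root (binL {G = G} s) = +-monoˡ-< (weight G) (Ctx-weight-> conn root s)
Ctx-weight-> conn root (binR {F = F} s) = +-monoʳ-< (weight F) (Ctx-weight-> conn root s)
Ctx-weight-> conn root (quantC s) rewrite Ctx-connectives conn s =
  +-monoˡ-< _ (Ctx-weight-> conn root s)

connectives-ACOroot : connectives Preserves ACOroot ⟶ _≡_
connectives-ACOroot (A {F₁ = F₁} {F₂} {F₃}) =
  reassoc (connectives F₁) (connectives F₂) (connectives F₃)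
  where
  reassoc : ∀ a b c → suc (a + suc (b + c)) ≡ suc (suc (a + b) + c)
  reassoc = solve-∀
connectives-ACOroot (A⁻ {o} {F₁} {F₂} {F₃}) = sym (connectives-ACOroot (A {o} {F₁} {F₂} {F₃}))
connectives-ACOroot (C {F₁ = F₁} {F₂})      = cong suc (+-comm (connectives F₁) (connectives F₂))
connectives-ACOroot O                       = refl

weight-ACOroot : weight Preserves ACOroot ⟶ _≡_
weight-ACOroot (A {F₁ = F₁} {F₂} {F₃})  = sym (+-assoc (weight F₁) (weight F₂) (weight F₃))
weight-ACOroot (A⁻ {F₁ = F₁} {F₂} {F₃}) = +-assoc (weight F₁) (weight F₂) (weight F₃)
weight-ACOroot (C {F₁ = F₁} {F₂})       = +-comm (weight F₁) (weight F₂)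
weight-ACOroot O                        = refl

connectives-PSMroot : connectives Preserves PSMroot ⟶ _≡_
connectives-PSMroot (P∃ _) = refl
connectives-PSMroot (P∀ _) = refl
connectives-PSMroot S∃     = refl
connectives-PSMroot S∀     = refl
connectives-PSMroot (M _)  = refl

<-by-excess : ∀ m k {n} → m + suc k ≡ n → m < n
<-by-excess m k refl = m<m+n m z<s

pushing-lowers-weight : ∀ w₁ w₂ c₁ c₂ →
                        (w₁ + suc (2 * c₁)) + w₂ < (w₁ + w₂) + suc (2 * suc (c₁ + c₂))
pushing-lowers-weight w₁ w₂ c₁ c₂ = <-by-excess _ (suc (2 * c₂)) (excess w₁ w₂ c₁ c₂)
  where
  excess : ∀ w₁ w₂ c₁ c₂ →
           (w₁ + suc (2 * c₁)) + w₂ + suc (suc (2 * c₂)) ≡ (w₁ + w₂) + suc (2 * suc (c₁ + c₂))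
  excess = solve-∀

splitting-lowers-weight : ∀ w₁ w₂ c₁ c₂ →
                          (w₁ + suc (2 * c₁)) + (w₂ + suc (2 * c₂)) < (w₁ + w₂) + suc (2 * suc (c₁ + c₂))
splitting-lowers-weight w₁ w₂ c₁ c₂ = <-by-excess _ 0 (excess w₁ w₂ c₁ c₂)
  where
  excess : ∀ w₁ w₂ c₁ c₂ →
           (w₁ + suc (2 * c₁)) + (w₂ + suc (2 * c₂)) + 1 ≡ (w₁ + w₂) + suc (2 * suc (c₁ + c₂))
  excess = solve-∀

weight-PSMroot : weight Preserves PSMroot ⟶ _>_
weight-PSMroot (P∃ {F₁ = F₁} {F₂} _) =
  pushing-lowers-weight (weight F₁) (weight F₂) (connectives F₁) (connectives F₂)
weight-PSMroot (P∀ {F₁ = F₁} {F₂} _) =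
  pushing-lowers-weight (weight F₁) (weight F₂) (connectives F₁) (connectives F₂)
weight-PSMroot (S∃ {F₁ = F₁} {F₂}) =
  splitting-lowers-weight (weight F₁) (weight F₂) (connectives F₁) (connectives F₂)
weight-PSMroot (S∀ {F₁ = F₁} {F₂}) =
  splitting-lowers-weight (weight F₁) (weight F₂) (connectives F₁) (connectives F₂)
weight-PSMroot (M {F = F} _) = <-by-excess (weight F) (2 * connectives F) refl

weight-≈ACO : weight Preserves _≈ACO_ ⟶ _≡_
weight-≈ACO = gfold isEquivalence weight (Ctx-weight connectives-ACOroot weight-ACOroot)

weight-⇒Y : weight Preserves _⇒Y_ ⟶ _>_
weight-⇒Y (_ , _ , ψ≈d , d→d' , d'≈ψ') rewrite weight-≈ACO ψ≈d | sym (weight-≈ACO d'≈ψ') =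
  Ctx-weight-> connectives-PSMroot weight-PSMroot d→d'

Chain-length≤weight : ∀ {n ψ} → Chain n ψ → n ≤ weight ψ
Chain-length≤weight stop       = z≤n
Chain-length≤weight (step s c) = ≤-<-trans (Chain-length≤weight c) (weight-⇒Y s)

connectives≤size : ∀ F → connectives F ≤ size F
connectives≤size (atom _ _)    = z≤n
connectives≤size (bin _ F G)   = s≤s (+-mono-≤ (connectives≤size F) (connectives≤size G))
connectives≤size (quant _ _ F) = m≤n⇒m≤1+n (connectives≤size F)

size-nonZero : ∀ F → NonZero (size F)
size-nonZero (atom _ _)    = _
size-nonZero (bin _ _ _)   = _
size-nonZero (quant _ _ _) = _

square-of-sum : ∀ a b → a * a + b * b ≤ suc (a + b) * suc (a + b)
square-of-sum a b = ≤-trans (m≤m+n (a * a + b * b) _) (≤-reflexive (expand a b))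
  where
  expand : ∀ a b → a * a + b * b + suc (2 * (a * b) + 2 * (a + b)) ≡ suc (a + b) * suc (a + b)
  expand = solve-∀

square-of-suc : ∀ s → s * s + suc (2 * s) ≡ suc s * suc s
square-of-suc = solve-∀

weight≤size² : ∀ F → weight F ≤ size F * size F
weight≤size² (atom _ _)    = z≤n
weight≤size² (bin _ F G)   =
  ≤-trans (+-mono-≤ (weight≤size² F) (weight≤size² G)) (square-of-sum (size F) (size G))
weight≤size² (quant _ _ F) =
  ≤-trans (+-mono-≤ (weight≤size² F) (s≤s (*-monoʳ-≤ 2 (connectives≤size F))))
          (≤-reflexive (square-of-suc (size F)))

weight≤size³ : ∀ F → weight F ≤ size F ^ 3
weight≤size³ F = begin
  weight F          ≤⟨ weight≤size² F ⟩
  size F * size F   ≡⟨ cong (size F *_) (sym (*-identityʳ (size F))) ⟩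
  size F ^ 2        ≤⟨ ^-monoʳ-≤ (size F) {{size-nonZero F}} (n≤1+n 2) ⟩
  size F ^ 3        ∎
  where open ≤-Reasoning

⇒Y-respˡ-≈ACO : ∀ {φ ψ ψ'} → φ ≈ACO ψ → ψ ⇒Y ψ' → φ ⇒Y ψ'
⇒Y-respˡ-≈ACO φ≈ψ (d , d' , ψ≈d , d→d' , d'≈ψ') = d , d' , transitive _→ACO_ φ≈ψ ψ≈d , d→d' , d'≈ψ'

Chain-respˡ-≈ACO : ∀ {n φ ψ} → φ ≈ACO ψ → Chain n ψ → Chain n φ
Chain-respˡ-≈ACO φ≈ψ stop       = stop
Chain-respˡ-≈ACO φ≈ψ (step s c) = step (⇒Y-respˡ-≈ACO φ≈ψ s) c

InfiniteChain⇒Chain : ∀ {φ} → InfiniteChain φ → ∀ n → Chain n φ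
InfiniteChain⇒Chain (f , f₀≈φ , f-steps) n =
  Chain-respˡ-≈ACO (symmetric _→ACO_ f₀≈φ) (chain-from 0 n)
  where
  chain-from : ∀ i n → Chain n (f i)
  chain-from i zero    = stop
  chain-from i (suc n) = step (f-steps i) (chain-from (suc i) n)

lemma7p1 : (φ : Formula) →
    ¬ InfiniteChain φ × (∀ (n : ℕ) → Chain n φ → n ≤ size φ ^ 3)
lemma7p1 φ = no-infinite-chain , chain-bound
  where
  chain-bound : ∀ n → Chain n φ → n ≤ size φ ^ 3
  chain-bound _ c = ≤-trans (Chain-length≤weight c) (weight≤size³ φ)

  no-infinite-chain : ¬ InfiniteChain φ
  no-infinite-chain inf = 1+n≰n (chain-bound _ (InfiniteChain⇒Chain inf (suc (size φ ^ 3))))
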